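{- Let $m \in \mathbb{N}$, $m > 1$, and let $N$ be a positive integer divisible by $2m$; put $s = N/(2m)$. Construct a network on $N$ nodes as follows: (i) split the nodes into $2m$ sets $V_1,\dots,V_{2m}$ of $s$ nodes each; (ii) link every pair of nodes within each set $V_i$; (iii) partition the nodes into $s$ vertex-disjoint cycles, each containing exactly one node from each of the sets $V_1,\dots,V_{2m}$ (so each cycle has length $2m$), and include the links of these cycles. Then the resulting network is $N/(2m)$-robust and has the minimum number of links among all $N/(2m)$-robust networks on $N$ nodes.
   Context: A network is a finite simple undirected graph; links are edges. For an integer $N_f$, a network $G$ is $N_f$-robust if for every set $S$ of $N_f$ nodes of $G$, the network obtained by deleting the nodes of $S$ and their incident links is connected. -}

module Defs where

open import Data.Nat using (ℕ; zero; suc; _<ᵇ_)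
open import Data.Nat.Properties using (_≟_)
open import Data.Bool using (Bool; true; false; _∧_; if_then_else_)
open import Data.Fin using (Fin; zero; suc; toℕ; lower₁)
open import Data.Fin.Subset using (Subset; _∉_; ∣_∣)
open import Data.List using (List; allFin; map)
open import Data.Nat.ListAction using (sum)
open import Data.Vec using (tabulate)
open import Data.Product using (_×_; ∃-syntax)
open import Data.Sum using (_⊎_)
open import Relation.Binary.PropositionalEquality using (_≡_; _≢_)
open import Relation.Nullary using (yes; no; does)
import Data.Fin as F

record Graph (n : ℕ) : Set where
  field
    adj   : Fin n → Fin n → Bool
    sym   : ∀ u v → adj u v ≡ adj v u
    irrefl : ∀ u → adj u u ≡ false
open Graph public

numLinks : ∀ {n} → Graph n → ℕ
numLinks {n} G =
  sum (map (λ u → sum (map (λ v → if adj G u v ∧ (toℕ u <ᵇ toℕ v) then 1 else 0)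
                            (allFin n)))
           (allFin n))

data WalkAvoiding {n} (G : Graph n) (S : Subset n) : Fin n → Fin n → Set where
  here : ∀ {u} → WalkAvoiding G S u u
  step : ∀ {u v w} → adj G u v ≡ true → v ∉ S → WalkAvoiding G S v w → WalkAvoiding G S u w

ConnectedAfterDeleting : ∀ {n} → Graph n → Subset n → Set
ConnectedAfterDeleting G S = ∀ u v → u ∉ S → v ∉ S → WalkAvoiding G S u v

Robust : ∀ {n} → ℕ → Graph n → Set
Robust {n} Nf G = ∀ (S : Subset n) → ∣ S ∣ ≡ Nf → ConnectedAfterDeleting G S

cycSucc : ∀ {L} → Fin L → Fin L
cycSucc {suc n} i with n ≟ toℕ i
... | yes _ = zero
... | no ne = suc (lower₁ i ne)

classOf : ∀ {n k} → (Fin n → Fin k) → Fin k → Subset n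
classOf part i = tabulate (λ u → does (part u F.≟ i))

ConstructionLink : ∀ {n s L} → (Fin n → Fin L) → (Fin s → Fin L → Fin n) →
                   Fin n → Fin n → Set
ConstructionLink part cyc u v =
  (u ≢ v × part u ≡ part v)
  ⊎ (∃[ k ] ∃[ j ] ((u ≡ cyc k j × v ≡ cyc k (cycSucc j))
                   ⊎ (v ≡ cyc k j × u ≡ cyc k (cycSucc j))))

-- An s-robust network on at least s + 2 nodes has minimum degree at least s + 1: a node of
-- degree at most s is cut off by deleting s nodes that contain its neighbours but not the node
-- itself nor some other node. By the handshake lemma such a network has at least N (s + 1) / 2
-- links, and the construction attains this, being (s + 1)-regular (s - 1 classmates and two cycle
-- neighbours). For robustness, delete s nodes. Either some cycle is intact, and every node reaches
-- it inside its class clique, or each of the s cycles lost exactly one node. A cycle that lost one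
-- node is still connected, and the cycles of u and v are joined inside the clique of a class
-- avoiding both deleted classes, which exists because there are at least three classes.
module Submission where

open import Defs hiding (sym)
open import Data.Nat using (ℕ; zero; suc; _+_; _∸_; _*_; _≤_; _<_; z≤n; s≤s; _<ᵇ_; _≟_; _≤?_)
open import Data.Nat.Properties
open import Data.Bool using (Bool; true; false; _∧_; _∨_; not; if_then_else_)
open import Data.Bool.Properties using (∨-inverseˡ; ∨-zeroʳ)
import Data.Bool as Bool
open import Data.Fin using (Fin; zero; suc; toℕ; fromℕ; inject₁)
import Data.Fin as F
import Data.Fin.Properties as FP
open import Data.Fin.Subset using (Subset; ∣_∣; _∈_; _∉_)
open import Data.Fin.Subset.Properties using (_∈?_)
open import Data.List using (allFin; map)
import Data.List as List using (tabulate)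
import Data.List.Properties as List using (map-tabulate)
open import Data.Nat.ListAction using () renaming (sum to listSum)
open import Data.Vec using (lookup; tabulate)
open import Data.Vec.Properties using (tabulate∘lookup; lookup∘tabulate; []=⇒lookup; lookup⇒[]=)
open import Data.Product using (_×_; _,_; ∃-syntax; proj₁; proj₂)
open import Data.Sum using (_⊎_; inj₁; inj₂; [_,_])
open import Data.Empty using (⊥; ⊥-elim)
open import Data.Vec.Functional using (removeAt)
open import Function using (id; _∘_)
open import Function.Bundles using (_⇔_; mk⇔; Equivalence)
open import Relation.Binary.PropositionalEquality
  using (_≡_; _≢_; refl; sym; trans; cong; cong₂; subst; subst₂; module ≡-Reasoning)
open import Relation.Nullary using (yes; no; does; ¬_; contradiction)
open import Relation.Nullary.Decidable using (dec-true; _→-dec_; _×-dec_)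

open import Algebra.Properties.CommutativeMonoid.Sum +-0-commutativeMonoid
  using (sum; sum-cong-≗; ∑-distrib-+; ∑-comm; sum-replicate-zero; sum-remove)

indicator : Bool → ℕ
indicator b = if b then 1 else 0

count : ∀ {n} → (Fin n → Bool) → ℕ
count P = sum (indicator ∘ P)

_⊆ᵇ_ : ∀ {n} → (Fin n → Bool) → (Fin n → Bool) → Set
P ⊆ᵇ Q = ∀ v → P v ≡ true → Q v ≡ true

singleton : ∀ {n} → Fin n → Fin n → Bool
singleton a v = does (v F.≟ a)

sum-mono-≤ : ∀ {n} {f g : Fin n → ℕ} → (∀ i → f i ≤ g i) → sum f ≤ sum g
sum-mono-≤ {zero}  f≤g = z≤n
sum-mono-≤ {suc n} f≤g = +-mono-≤ (f≤g zero) (sum-mono-≤ (f≤g ∘ suc))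

size≤sum : ∀ {n} (f : Fin n → ℕ) → (∀ i → 1 ≤ f i) → n ≤ sum f
size≤sum {zero}  f pos = z≤n
size≤sum {suc n} f pos = +-mono-≤ (pos zero) (size≤sum (f ∘ suc) (pos ∘ suc))

sum≡size⇒≤1 : ∀ {n} (f : Fin n → ℕ) → (∀ i → 1 ≤ f i) → sum f ≡ n → ∀ i → f i ≤ 1
sum≡size⇒≤1 {suc n} f pos sum≡ i = +-cancelʳ-≤ n (f i) 1 (begin
  f i + n                    ≤⟨ +-monoʳ-≤ (f i) (size≤sum _ (λ _ → pos _)) ⟩
  f i + sum (removeAt f i)   ≡⟨ sum-remove f ⟨
  sum f                      ≡⟨ sum≡ ⟩
  suc n                      ∎)
  where open ≤-Reasoning

count-cong : ∀ {n} {P Q : Fin n → Bool} → (∀ v → P v ≡ Q v) → count P ≡ count Q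
count-cong P≗Q = sum-cong-≗ (cong indicator ∘ P≗Q)

indicator-mono : ∀ {a b} → (a ≡ true → b ≡ true) → indicator a ≤ indicator b
indicator-mono {false}     a⇒b = z≤n
indicator-mono {true}  {b} a⇒b rewrite a⇒b refl = ≤-refl

count-mono : ∀ {n} {P Q : Fin n → Bool} → P ⊆ᵇ Q → count P ≤ count Q
count-mono P⊆Q = sum-mono-≤ (indicator-mono ∘ P⊆Q)

indicator-⊎ : ∀ {a b c} → (a ≡ true ⇔ (b ≡ true ⊎ c ≡ true)) → (b ≡ true → c ≡ true → ⊥) →
              indicator a ≡ indicator b + indicator c
indicator-⊎ {b = true}  {true}  _ disj = ⊥-elim (disj refl refl)
indicator-⊎ {true}  {false} {false} a⇔ _ with Equivalence.to a⇔ refl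
... | inj₁ ()
... | inj₂ ()
indicator-⊎ {false} {true}          a⇔ _ with () ← Equivalence.from a⇔ (inj₁ refl)
indicator-⊎ {false} {false} {true}  a⇔ _ with () ← Equivalence.from a⇔ (inj₂ refl)
indicator-⊎ {true}  {true}  {false} _  _ = refl
indicator-⊎ {true}  {false} {true}  _  _ = refl
indicator-⊎ {false} {false} {false} _  _ = refl

count-⊎ : ∀ {n} {R P Q : Fin n → Bool} → (∀ v → R v ≡ true ⇔ (P v ≡ true ⊎ Q v ≡ true)) →
          (∀ v → P v ≡ true → Q v ≡ true → ⊥) → count R ≡ count P + count Q
count-⊎ {P = P} {Q} R⇔ disj =
  trans (sum-cong-≗ (λ v → indicator-⊎ (R⇔ v) (disj v))) (∑-distrib-+ (indicator ∘ P) (indicator ∘ Q))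

count-singleton : ∀ {n} (a : Fin n) → count (singleton a) ≡ 1
count-singleton {suc n} zero    = cong suc (sum-replicate-zero n)
count-singleton {suc n} (suc a) = count-singleton a

count-all : ∀ {n} → count {n} (λ _ → true) ≡ n
count-all {zero}  = refl
count-all {suc n} = cong suc (count-all {n})

singleton⇒≡ : ∀ {n} {a : Fin n} v → singleton a v ≡ true → v ≡ a
singleton⇒≡ {a = a} v eq with v F.≟ a
... | yes v≡a = v≡a

≡⇒singleton : ∀ {n} {a v : Fin n} → v ≡ a → singleton a v ≡ true
≡⇒singleton {a = a} {v} = dec-true (v F.≟ a)

singleton-⊆ : ∀ {n} {P : Fin n → Bool} {a} → P a ≡ true → singleton a ⊆ᵇ P
singleton-⊆ {P = P} Pa v v≡a = subst (λ w → P w ≡ true) (sym (singleton⇒≡ v v≡a)) Pa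

∨-≡true : ∀ a {b} → (a ∨ b ≡ true) ⇔ (a ≡ true ⊎ b ≡ true)
∨-≡true true  = mk⇔ (λ _ → inj₁ refl) (λ _ → refl)
∨-≡true false = mk⇔ inj₂ [ (λ ()) , id ]

count-∨ : ∀ {n} {P Q : Fin n → Bool} → (∀ v → P v ≡ true → Q v ≡ true → ⊥) →
          count (λ v → P v ∨ Q v) ≡ count P + count Q
count-∨ {P = P} = count-⊎ (λ v → ∨-≡true (P v))

count-≥1 : ∀ {n} {P : Fin n → Bool} {x} → P x ≡ true → 1 ≤ count P
count-≥1 {P = P} {x} Px = subst (_≤ count P) (count-singleton x) (count-mono {Q = P} (singleton-⊆ Px))

count-≥2 : ∀ {n} {P : Fin n → Bool} {x y} → x ≢ y → P x ≡ true → P y ≡ true → 2 ≤ count P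
count-≥2 {P = P} {x} {y} x≢y Px Py = begin
  2                                                ≡⟨ cong₂ _+_ (count-singleton x) (count-singleton y) ⟨
  count (singleton x) + count (singleton y)        ≡⟨ count-∨ {P = singleton x} x≠y ⟨
  count (λ v → singleton x v ∨ singleton y v)      ≤⟨ count-mono {Q = P} xy⊆P ⟩
  count P                                          ∎
  where
  open ≤-Reasoning
  x≠y : ∀ v → singleton x v ≡ true → singleton y v ≡ true → ⊥
  x≠y v v≡x v≡y = x≢y (trans (sym (singleton⇒≡ {a = x} v v≡x)) (singleton⇒≡ {a = y} v v≡y))
  xy⊆P : (λ v → singleton x v ∨ singleton y v) ⊆ᵇ P
  xy⊆P v xy with Equivalence.to (∨-≡true (singleton x v)) xy
  ... | inj₁ v≡x = singleton-⊆ Px v v≡x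
  ... | inj₂ v≡y = singleton-⊆ Py v v≡y

count-<⇒∃ : ∀ {n} {P Q : Fin n → Bool} → count P < count Q → ∃[ v ] Q v ≡ true × P v ≡ false
count-<⇒∃ {n} {P} {Q} P<Q =
  let v , Q⊈P = FP.¬∀⟶∃¬ n (λ v → Q v ≡ true → P v ≡ true) (λ v → Q v Bool.≟ true →-dec P v Bool.≟ true)
                  (λ Q⊆P → <⇒≱ P<Q (count-mono Q⊆P))
  in v , witness (Q v) (P v) Q⊈P
  where
  witness : ∀ a b → ¬ (a ≡ true → b ≡ true) → a ≡ true × b ≡ false
  witness true  false _   = refl , refl
  witness _     true  a⊈b = contradiction (λ _ → refl) a⊈b
  witness false _     a⊈b = contradiction (λ ()) a⊈b

count-insert : ∀ {n} {P : Fin n → Bool} {v} → P v ≡ false → count (λ x → P x ∨ singleton v x) ≡ suc (count P)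
count-insert {P = P} {v} Pv = begin
  count (λ x → P x ∨ singleton v x)   ≡⟨ count-∨ {P = P} v∉P ⟩
  count P + count (singleton v)       ≡⟨ cong (count P +_) (count-singleton v) ⟩
  count P + 1                         ≡⟨ +-comm (count P) 1 ⟩
  suc (count P)                       ∎
  where
  open ≡-Reasoning
  v∉P : ∀ x → P x ≡ true → singleton v x ≡ true → ⊥
  v∉P x Px x≡v with () ← trans (sym Pv) (subst (λ w → P w ≡ true) (singleton⇒≡ x x≡v) Px)

count-grow : ∀ {n} {P : Fin n → Bool} d R → R ⊆ᵇ P → d + count R ≤ count P →
             ∃[ Q ] R ⊆ᵇ Q × Q ⊆ᵇ P × count Q ≡ d + count R
count-grow zero R R⊆P _ = R , (λ _ → id) , R⊆P , refl
count-grow {P = P} (suc d) R R⊆P bound =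
  let v , Pv , Rv = count-<⇒∃ {P = R} (≤-trans (s≤s (m≤n+m (count R) d)) bound)
      R′ = λ x → R x ∨ singleton v x
      count-R′ = count-insert {P = R} Rv
      Q , R′⊆Q , Q⊆P , countQ = count-grow d R′ (R′⊆P v Pv)
        (subst (λ c → d + c ≤ count P) (sym count-R′) (subst (_≤ count P) (sym (+-suc d (count R))) bound))
  in Q , (λ x Rx → R′⊆Q x (Equivalence.from (∨-≡true (R x)) (inj₁ Rx))) , Q⊆P ,
     trans countQ (trans (cong (d +_) count-R′) (+-suc d (count R)))
  where
  R′⊆P : ∀ v → P v ≡ true → (λ x → R x ∨ singleton v x) ⊆ᵇ P
  R′⊆P v Pv x R′x with Equivalence.to (∨-≡true (R x)) R′x
  ... | inj₁ Rx   = R⊆P x Rx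
  ... | inj₂ x≡v  = singleton-⊆ Pv x x≡v

count-between : ∀ {n} {R P : Fin n → Bool} k → R ⊆ᵇ P → count R ≤ k → k ≤ count P →
                ∃[ Q ] R ⊆ᵇ Q × Q ⊆ᵇ P × count Q ≡ k
count-between {R = R} {P} k R⊆P R≤k k≤P =
  let Q , R⊆Q , Q⊆P , countQ = count-grow (k ∸ count R) R R⊆P (subst (_≤ count P) (sym (m∸n+n≡m R≤k)) k≤P)
  in Q , R⊆Q , Q⊆P , trans countQ (m∸n+n≡m R≤k)

∣tabulate∣≡count : ∀ {n} (P : Fin n → Bool) → ∣ tabulate P ∣ ≡ count P
∣tabulate∣≡count {zero}  P = refl
∣tabulate∣≡count {suc n} P with P zero
... | true  = cong suc (∣tabulate∣≡count (P ∘ suc))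
... | false = ∣tabulate∣≡count (P ∘ suc)

∣S∣≡count : ∀ {n} (S : Subset n) → ∣ S ∣ ≡ count (lookup S)
∣S∣≡count S = trans (cong ∣_∣ (sym (tabulate∘lookup S))) (∣tabulate∣≡count (lookup S))

∈⇒lookup : ∀ {n} {S : Subset n} {x} → x ∈ S → lookup S x ≡ true
∈⇒lookup = []=⇒lookup

lookup⇒∈ : ∀ {n} {S : Subset n} {x} → lookup S x ≡ true → x ∈ S
lookup⇒∈ {S = S} {x} = lookup⇒[]= x S

∈-tabulate : ∀ {n} {P : Fin n → Bool} {x} → x ∈ tabulate P → P x ≡ true
∈-tabulate {P = P} {x} x∈ = trans (sym (lookup∘tabulate P x)) (∈⇒lookup x∈)

tabulate-∈ : ∀ {n} {P : Fin n → Bool} {x} → P x ≡ true → x ∈ tabulate P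
tabulate-∈ {P = P} {x} Px = lookup⇒∈ (trans (lookup∘tabulate P x) Px)

listSum≡sum : ∀ {n} (f : Fin n → ℕ) → listSum (map f (allFin n)) ≡ sum f
listSum≡sum {n} f = trans (cong listSum (List.map-tabulate id f)) (tabulated f)
  where
  tabulated : ∀ {n} (f : Fin n → ℕ) → listSum (List.tabulate f) ≡ sum f
  tabulated {zero}  f = refl
  tabulated {suc n} f = cong (f zero +_) (tabulated (f ∘ suc))

degree : ∀ {n} → Graph n → Fin n → ℕ
degree G u = count (adj G u)

handshake : ∀ {n} (G : Graph n) → 2 * numLinks G ≡ sum (degree G)
handshake {n} G = begin
  2 * numLinks G                                        ≡⟨ cong (numLinks G +_) (+-identityʳ _) ⟩
  numLinks G + numLinks G                               ≡⟨ cong₂ _+_ numLinks≡ (trans numLinks≡ (∑-comm L)) ⟩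
  sum (λ u → sum (L u)) + sum (λ u → sum (λ v → L v u)) ≡⟨ ∑-distrib-+ (λ u → sum (L u)) _ ⟨
  sum (λ u → sum (L u) + sum (λ v → L v u))            ≡⟨ sum-cong-≗ (λ u → ∑-distrib-+ (L u) (λ v → L v u)) ⟨
  sum (λ u → sum (λ v → L u v + L v u))                ≡⟨ sum-cong-≗ (λ u → sum-cong-≗ (L-sym u)) ⟩
  sum (degree G)                                        ∎
  where
  open ≡-Reasoning
  L : Fin n → Fin n → ℕ
  L u v = indicator (adj G u v ∧ (toℕ u <ᵇ toℕ v))
  numLinks≡ : numLinks G ≡ sum (λ u → sum (L u))
  numLinks≡ = trans (listSum≡sum (λ u → listSum (map (L u) (allFin n)))) (sum-cong-≗ (λ u → listSum≡sum (L u)))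
  <ᵇ-trichotomy : ∀ a b → a ≢ b → indicator (a <ᵇ b) + indicator (b <ᵇ a) ≡ 1
  <ᵇ-trichotomy zero    zero    a≢b = contradiction refl a≢b
  <ᵇ-trichotomy zero    (suc b) _   = refl
  <ᵇ-trichotomy (suc a) zero    _   = refl
  <ᵇ-trichotomy (suc a) (suc b) a≢b = <ᵇ-trichotomy a b (a≢b ∘ cong suc)
  L-sym : ∀ u v → L u v + L v u ≡ indicator (adj G u v)
  L-sym u v rewrite Graph.sym G v u with adj G u v in uv
  ... | false = refl
  ... | true  = <ᵇ-trichotomy (toℕ u) (toℕ v) (λ u≡v → loop (FP.toℕ-injective u≡v))
    where
    loop : u ≢ v
    loop refl with () ← trans (sym uv) (irrefl G u)

module _ {n} {G : Graph n} {S : Subset n} where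

  walk-++ : ∀ {x y z} → WalkAvoiding G S x y → WalkAvoiding G S y z → WalkAvoiding G S x z
  walk-++ here               q = q
  walk-++ (step xy y∉S p) q = step xy y∉S (walk-++ p q)

  walk-snoc : ∀ {x y z} → WalkAvoiding G S x y → adj G y z ≡ true → z ∉ S → WalkAvoiding G S x z
  walk-snoc p yz z∉S = walk-++ p (step yz z∉S here)

  walk-reverse : ∀ {x y} → x ∉ S → WalkAvoiding G S x y → WalkAvoiding G S y x
  walk-reverse x∉S here                        = here
  walk-reverse {x} x∉S (step {v = v} xv v∉S p) = walk-snoc (walk-reverse v∉S p) (trans (Graph.sym G v x) xv) x∉S

neighbourhood-cut : ∀ {n} {H : Graph n} {S : Subset n} {u v} → (∀ x → adj H u x ≡ true → x ∈ S) →
                    u ≢ v → ¬ WalkAvoiding H S u v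
neighbourhood-cut N[u]⊆S u≢v here               = u≢v refl
neighbourhood-cut N[u]⊆S u≢v (step ux x∉S _) = x∉S (N[u]⊆S _ ux)

isolating-set : ∀ {n} s (H : Graph n) u → s + 2 ≤ n → degree H u ≤ s →
                ∃[ S ] ∣ S ∣ ≡ s × u ∉ S × (∀ x → adj H u x ≡ true → x ∈ S) × ∃[ v ] v ∉ S × u ≢ v
isolating-set {n} s H u s+2≤n deg≤s =
  let S , N[u]⊆S , S⊆others , ∣S∣ = count-between s N[u]⊆others deg≤s (≤-trans (n≤1+n s) s<others)
      v , v-other , v∉S = count-<⇒∃ {P = S} (subst (_< count others) (sym ∣S∣) s<others)
  in tabulate S , trans (∣tabulate∣≡count S) ∣S∣ ,
     (λ u∈S → contradiction (trans (sym others-u) (S⊆others u (∈-tabulate u∈S))) λ ()) ,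
     (λ x ux → tabulate-∈ (N[u]⊆S x ux)) ,
     v , (λ v∈S → contradiction (trans (sym v∉S) (∈-tabulate v∈S)) λ ()) ,
     (λ u≡v → contradiction (trans (sym others-u) (subst (λ w → others w ≡ true) (sym u≡v) v-other)) λ ())
  where
  others : Fin n → Bool
  others v = not (singleton u v)
  others-u : others u ≡ false
  others-u = cong not (≡⇒singleton {a = u} refl)
  N[u]⊆others : adj H u ⊆ᵇ others
  N[u]⊆others v uv with v F.≟ u
  ... | yes refl = contradiction (trans (sym uv) (irrefl H u)) λ ()
  ... | no  _    = refl
  n≡1+others : n ≡ suc (count others)
  n≡1+others = begin
    n                                        ≡⟨ count-all {n} ⟨
    count {n} (λ _ → true)                   ≡⟨ count-cong (λ x → ∨-inverseˡ (singleton u x)) ⟨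
    count (λ x → others x ∨ singleton u x)   ≡⟨ count-insert {P = others} others-u ⟩
    suc (count others)                       ∎
    where open ≡-Reasoning
  s<others : s < count others
  s<others = ≤-pred (subst₂ _≤_ (+-comm s 2) n≡1+others s+2≤n)

robust⇒degree≥ : ∀ {n} s (H : Graph n) → s + 2 ≤ n → Robust s H → ∀ u → suc s ≤ degree H u
robust⇒degree≥ s H s+2≤n robust u with suc s ≤? degree H u
... | yes s<deg = s<deg
... | no  s≮deg =
  let S , ∣S∣ , u∉S , N[u]⊆S , v , v∉S , u≢v = isolating-set s H u s+2≤n (≤-pred (≰⇒> s≮deg))
  in contradiction (robust S ∣S∣ u v u∉S v∉S) (neighbourhood-cut N[u]⊆S u≢v)

regular⇒fewest-links : ∀ {n} s (G H : Graph n) → s + 2 ≤ n → (∀ u → degree G u ≡ suc s) →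
                       Robust s H → numLinks G ≤ numLinks H
regular⇒fewest-links s G H s+2≤n regular robust = *-cancelˡ-≤ 2 (begin
  2 * numLinks G    ≡⟨ handshake G ⟩
  sum (degree G)    ≤⟨ sum-mono-≤ degree≤ ⟩
  sum (degree H)    ≡⟨ handshake H ⟨
  2 * numLinks H    ∎)
  where
  open ≤-Reasoning
  degree≤ : ∀ u → degree G u ≤ degree H u
  degree≤ u = subst (_≤ degree H u) (sym (regular u)) (robust⇒degree≥ s H s+2≤n robust u)

toℕ-cycSucc : ∀ {n} (j : Fin (suc n)) → (toℕ j ≡ n × cycSucc j ≡ zero) ⊎ toℕ (cycSucc j) ≡ suc (toℕ j)
toℕ-cycSucc {n} j with n ≟ toℕ j
... | yes n≡j = inj₁ (sym n≡j , refl)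
... | no  n≢j = inj₂ (cong suc (FP.toℕ-lower₁ j n≢j))

cycSucc-fromℕ : ∀ n → cycSucc (fromℕ n) ≡ zero
cycSucc-fromℕ n with toℕ-cycSucc (fromℕ n)
... | inj₁ (_ , wraps) = wraps
... | inj₂ next        = contradiction (FP.toℕ<n (cycSucc (fromℕ n))) (<-irrefl (trans next (cong suc (FP.toℕ-fromℕ n))))

cycSucc-inject₁ : ∀ {n} (i : Fin n) → cycSucc (inject₁ i) ≡ suc i
cycSucc-inject₁ {n} i with toℕ-cycSucc (inject₁ i)
... | inj₁ (last , _) = contradiction (sym last) (FP.toℕ-inject₁-≢ i)
... | inj₂ next       = FP.toℕ-injective (trans next (cong suc (FP.toℕ-inject₁ i)))

cycPred : ∀ {n} → Fin (suc n) → Fin (suc n)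
cycPred {n} zero = fromℕ n
cycPred (suc i)  = inject₁ i

cycSucc-cycPred : ∀ {n} (j : Fin (suc n)) → cycSucc (cycPred j) ≡ j
cycSucc-cycPred {n} zero = cycSucc-fromℕ n
cycSucc-cycPred (suc i)  = cycSucc-inject₁ i

cycSucc-injective : ∀ {n} {a b : Fin (suc n)} → cycSucc a ≡ cycSucc b → a ≡ b
cycSucc-injective {a = a} {b} eq with toℕ-cycSucc a | toℕ-cycSucc b
... | inj₁ (a-last , _)  | inj₁ (b-last , _)  = FP.toℕ-injective (trans a-last (sym b-last))
... | inj₁ (_ , a-wraps) | inj₂ b-next        = contradiction (trans (sym b-next) (cong toℕ (trans (sym eq) a-wraps))) λ ()
... | inj₂ a-next        | inj₁ (_ , b-wraps) = contradiction (trans (sym a-next) (cong toℕ (trans eq b-wraps))) λ ()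
... | inj₂ a-next        | inj₂ b-next        =
  FP.toℕ-injective (suc-injective (trans (sym a-next) (trans (cong toℕ eq) b-next)))

cycSucc-≢ : ∀ {n} → 1 ≤ n → (j : Fin (suc n)) → cycSucc j ≢ j
cycSucc-≢ 1≤n j fixed with toℕ-cycSucc j
... | inj₁ (last , wraps) = <⇒≢ 1≤n (trans (cong toℕ (trans (sym wraps) fixed)) last)
... | inj₂ next           = 1+n≢n (trans (sym next) (cong toℕ fixed))

cycSucc²-≢ : ∀ {n} → 2 ≤ n → (j : Fin (suc n)) → cycSucc (cycSucc j) ≢ j
cycSucc²-≢ 2≤n j back with toℕ-cycSucc j | toℕ-cycSucc (cycSucc j)
... | inj₁ (_ , wraps)    | inj₁ (zero-last , _) =
  <⇒≢ (≤-trans (s≤s z≤n) 2≤n) (trans (cong toℕ (sym wraps)) zero-last)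
... | inj₁ (last , wraps) | inj₂ next             =
  <⇒≢ 2≤n (trans (cong (suc ∘ toℕ) (sym wraps)) (trans (sym next) (trans (cong toℕ back) last)))
... | inj₂ next           | inj₁ (last , wraps)  =
  <⇒≢ 2≤n (sym (trans (sym last) (trans next (cong (suc ∘ toℕ) (trans (sym back) wraps)))))
... | inj₂ next           | inj₂ next²           =
  <⇒≢ (m<n⇒m<1+n (n<1+n _)) (trans (sym (cong toℕ back)) (trans next² (cong suc next)))

cycle⇒path : ∀ {n m} (G : Graph n) (c : Fin (suc m) → Fin n) → (∀ j → adj G (c j) (c (cycSucc j)) ≡ true) →
             ∀ i → adj G (c (inject₁ i)) (c (suc i)) ≡ true
cycle⇒path G c edge i = subst (λ j → adj G (c (inject₁ i)) (c j) ≡ true) (cycSucc-inject₁ i) (edge (inject₁ i))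

module _ {n} {G : Graph n} {S : Subset n} where

  path-walk : ∀ {m} (p : Fin (suc m) → Fin n) → (∀ i → adj G (p (inject₁ i)) (p (suc i)) ≡ true) →
              ∀ {a b} → a F.≤ b → (∀ j → a F.≤ j → j F.≤ b → p j ∉ S) → WalkAvoiding G S (p a) (p b)
  path-walk p edge {zero}  {zero}  _          clear = here
  path-walk {suc m} p edge {zero}  {suc b} _          clear =
    step (edge zero) (clear (suc zero) z≤n (s≤s z≤n))
      (path-walk (p ∘ suc) (edge ∘ suc) {zero} z≤n (λ j _ j≤b → clear (suc j) z≤n (s≤s j≤b)))
  path-walk {suc m} p edge {suc a} {suc b} (s≤s a≤b) clear =
    path-walk (p ∘ suc) (edge ∘ suc) a≤b (λ j a≤j j≤b → clear (suc j) (s≤s a≤j) (s≤s j≤b))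

  deleted-only-at : ∀ {m} {c : Fin m → Fin n} {p} → (∀ j → c j ∈ S → j ≡ p) →
                    (P : Fin m → Set) → (P p → c p ∉ S) → ∀ j → P j → c j ∉ S
  deleted-only-at only P Pp⇒p∉S j Pj j∈S with only j j∈S
  ... | refl = Pp⇒p∉S Pj j∈S

  cycle-walk-≤ : ∀ {m} (c : Fin (suc m) → Fin n) → (∀ j → adj G (c j) (c (cycSucc j)) ≡ true) →
                 ∀ p → (∀ j → c j ∈ S → j ≡ p) → ∀ {a b} → a F.≤ b → c a ∉ S → c b ∉ S →
                 WalkAvoiding G S (c a) (c b)
  cycle-walk-≤ {m} c edge p only {a} {b} a≤b a∉S b∉S with (a FP.≤? p) ×-dec (p FP.≤? b)
  ... | no p∉[a,b] =
    path-walk c path a≤b λ j a≤j j≤b →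
      deleted-only-at only _ (λ p∈[a,b] → contradiction p∈[a,b] p∉[a,b]) j (a≤j , j≤b)
    where path = cycle⇒path G c edge
  ... | yes (a≤p , p≤b) =
    -- the only deleted position may lie between a and b: go round through the last position and zero
    walk-++ (walk-reverse (clear-below zero z≤n) (path-walk c path z≤n (λ j _ → clear-below j)))
      (step (trans (Graph.sym G _ _) last-edge) (clear-above last (FP.≤fromℕ b))
        (walk-reverse b∉S (path-walk c path (FP.≤fromℕ b) (λ j b≤j _ → clear-above j b≤j))))
    where
    path = cycle⇒path G c edge
    last = fromℕ m
    last-edge : adj G (c last) (c zero) ≡ true
    last-edge = subst (λ j → adj G (c last) (c j) ≡ true) (cycSucc-fromℕ m) (edge last)
    clear-below : ∀ j → j F.≤ a → c j ∉ S
    clear-below = deleted-only-at only (F._≤ a) (λ p≤a → subst (λ k → c k ∉ S) (FP.≤-antisym a≤p p≤a) a∉S)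
    clear-above : ∀ j → b F.≤ j → c j ∉ S
    clear-above = deleted-only-at only (b F.≤_) (λ b≤p → subst (λ k → c k ∉ S) (FP.≤-antisym b≤p p≤b) b∉S)

  cycle-walk : ∀ {m} (c : Fin (suc m) → Fin n) → (∀ j → adj G (c j) (c (cycSucc j)) ≡ true) →
               ∀ p → (∀ j → c j ∈ S → j ≡ p) → ∀ a b → c a ∉ S → c b ∉ S → WalkAvoiding G S (c a) (c b)
  cycle-walk c edge p only a b a∉S b∉S with FP.≤-total a b
  ... | inj₁ a≤b = cycle-walk-≤ c edge p only a≤b a∉S b∉S
  ... | inj₂ b≤a = walk-reverse b∉S (cycle-walk-≤ c edge p only b≤a b∉S a∉S)

avoid-two : ∀ {n} → 2 ≤ n → (a b : Fin (suc n)) → ∃[ c ] c ≢ a × c ≢ b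
avoid-two {suc zero} (s≤s ()) _ _
avoid-two {suc (suc n)} _ zero          zero          = suc zero , (λ ()) , (λ ())
avoid-two {suc (suc n)} _ zero          (suc zero)    = suc (suc zero) , (λ ()) , (λ ())
avoid-two {suc (suc n)} _ zero          (suc (suc b)) = suc zero , (λ ()) , (λ ())
avoid-two {suc (suc n)} _ (suc zero)    zero          = suc (suc zero) , (λ ()) , (λ ())
avoid-two {suc (suc n)} _ (suc zero)    (suc b)       = zero , (λ ()) , (λ ())
avoid-two {suc (suc n)} _ (suc (suc a)) zero          = suc zero , (λ ()) , (λ ())
avoid-two {suc (suc n)} _ (suc (suc a)) (suc b)       = zero , (λ ()) , (λ ())

module Construction {N s n : ℕ} (2≤n : 2 ≤ n)
  (part : Fin N → Fin (suc n))
  (class-size : ∀ i → ∣ classOf part i ∣ ≡ s)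
  (cyc : Fin s → Fin (suc n) → Fin N)
  (cyc-injective : ∀ k j k′ j′ → cyc k j ≡ cyc k′ j′ → k ≡ k′ × j ≡ j′)
  (cyc-surjective : ∀ u → ∃[ k ] ∃[ j ] cyc k j ≡ u)
  (rainbow : ∀ k j j′ → part (cyc k j) ≡ part (cyc k j′) → j ≡ j′)
  (G : Graph N)
  (links : ∀ u v → (adj G u v ≡ true) ⇔ ConstructionLink part cyc u v)
  where

  private
    1≤n : 1 ≤ n
    1≤n = ≤-trans (s≤s z≤n) 2≤n

  cycleOf : Fin N → Fin s
  cycleOf u = proj₁ (cyc-surjective u)

  positionOf : Fin N → Fin (suc n)
  positionOf u = proj₁ (proj₂ (cyc-surjective u))

  cyc-position : ∀ u → cyc (cycleOf u) (positionOf u) ≡ u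
  cyc-position u = proj₂ (proj₂ (cyc-surjective u))

  cycleOf-cyc : ∀ k j → cycleOf (cyc k j) ≡ k
  cycleOf-cyc k j = proj₁ (cyc-injective _ _ k j (cyc-position (cyc k j)))

  class-edge : ∀ {u v} → u ≢ v → part u ≡ part v → adj G u v ≡ true
  class-edge u≢v same = Equivalence.from (links _ _) (inj₁ (u≢v , same))

  cycle-edge : ∀ k j → adj G (cyc k j) (cyc k (cycSucc j)) ≡ true
  cycle-edge k j = Equivalence.from (links _ _) (inj₂ (k , j , inj₁ (refl , refl)))

  cycle-edge⁻ : ∀ k j → adj G (cyc k (cycSucc j)) (cyc k j) ≡ true
  cycle-edge⁻ k j = Equivalence.from (links _ _) (inj₂ (k , j , inj₂ (refl , refl)))

  neighbour-cases : ∀ k j {v} → adj G (cyc k j) v ≡ true →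
                    part v ≡ part (cyc k j) ⊎ v ≡ cyc k (cycSucc j) ⊎ v ≡ cyc k (cycPred j)
  neighbour-cases k j uv with Equivalence.to (links _ _) uv
  ... | inj₁ (_ , same) = inj₁ (sym same)
  ... | inj₂ (k′ , j′ , inj₁ (u≡ , v≡)) with cyc-injective k j k′ j′ u≡
  ...   | refl , refl = inj₂ (inj₁ v≡)
  neighbour-cases k j uv | inj₂ (k′ , j′ , inj₂ (v≡ , u≡)) with cyc-injective k j k′ (cycSucc j′) u≡
  ...   | refl , j≡ =
    inj₂ (inj₂ (subst (λ i → _ ≡ cyc k i) (cycSucc-injective (trans (sym j≡) (sym (cycSucc-cycPred j)))) v≡))

  -- A cycle missing class c would inject its suc n positions into the n classes other than c.
  cycle-meets-class : ∀ k c → ∃[ j ] part (cyc k j) ≡ c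
  cycle-meets-class k c with FP.any? (λ j → part (cyc k j) F.≟ c)
  ... | yes hit  = hit
  ... | no  miss = contradiction (FP.injective⇒≤ other-class-injective) 1+n≰n
    where
    misses : ∀ j → c ≢ part (cyc k j)
    misses j c≡ = miss (j , sym c≡)
    other-class : Fin (suc n) → Fin n
    other-class j = F.punchOut (misses j)
    other-class-injective : ∀ {x y} → other-class x ≡ other-class y → x ≡ y
    other-class-injective eq = rainbow k _ _ (FP.punchOut-injective (misses _) (misses _) eq)

  node : Fin s → Fin (suc n) → Fin N
  node k c = cyc k (proj₁ (cycle-meets-class k c))

  part-node : ∀ k c → part (node k c) ≡ c
  part-node k c = proj₂ (cycle-meets-class k c)

  node-part : ∀ u → node (cycleOf u) (part u) ≡ u
  node-part u = trans (cong (cyc (cycleOf u)) position≡) (cyc-position u)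
    where
    position≡ : proj₁ (cycle-meets-class (cycleOf u) (part u)) ≡ positionOf u
    position≡ = rainbow _ _ _ (trans (part-node _ _) (cong part (sym (cyc-position u))))

  module _ (k : Fin s) (j : Fin (suc n)) where
    private
      u a b : Fin N
      u = cyc k j
      a = cyc k (cycSucc j)
      b = cyc k (cycPred j)
      classmate cycle-neighbour : Fin N → Bool
      classmate v = singleton (part u) (part v)
      cycle-neighbour v = singleton a v ∨ singleton b v

    closed-neighbourhood : ∀ v → (adj G u v ∨ singleton u v ≡ true) ⇔ (classmate v ≡ true ⊎ cycle-neighbour v ≡ true)
    closed-neighbourhood v = mk⇔ to from
      where
      to : adj G u v ∨ singleton u v ≡ true → classmate v ≡ true ⊎ cycle-neighbour v ≡ true
      to N[u]v with Equivalence.to (∨-≡true (adj G u v)) N[u]v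
      ... | inj₂ v≡u = inj₁ (≡⇒singleton (cong part (singleton⇒≡ v v≡u)))
      ... | inj₁ uv with neighbour-cases k j uv
      ...   | inj₁ same          = inj₁ (≡⇒singleton same)
      ...   | inj₂ (inj₁ v≡a)    = inj₂ (Equivalence.from (∨-≡true (singleton a v)) (inj₁ (≡⇒singleton v≡a)))
      ...   | inj₂ (inj₂ v≡b)    = inj₂ (Equivalence.from (∨-≡true (singleton a v)) (inj₂ (≡⇒singleton v≡b)))
      from : classmate v ≡ true ⊎ cycle-neighbour v ≡ true → adj G u v ∨ singleton u v ≡ true
      from (inj₁ same) with v F.≟ u
      ... | yes _   = ∨-zeroʳ (adj G u v)
      ... | no  v≢u = cong (_∨ false) (class-edge (v≢u ∘ sym) (sym (singleton⇒≡ (part v) same)))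
      from (inj₂ cn) = cong (_∨ singleton u v) (adjacent (Equivalence.to (∨-≡true (singleton a v)) cn))
        where
        adjacent : singleton a v ≡ true ⊎ singleton b v ≡ true → adj G u v ≡ true
        adjacent (inj₁ v≡a) = subst (λ w → adj G u w ≡ true) (sym (singleton⇒≡ v v≡a)) (cycle-edge k j)
        adjacent (inj₂ v≡b) = subst₂ (λ i w → adj G (cyc k i) w ≡ true) (cycSucc-cycPred j) (sym (singleton⇒≡ v v≡b))
                                (cycle-edge⁻ k (cycPred j))

    classmate-not-cycle-neighbour : ∀ v → classmate v ≡ true → cycle-neighbour v ≡ true → ⊥
    classmate-not-cycle-neighbour v same cn with Equivalence.to (∨-≡true (singleton a v)) cn
    ... | inj₁ v≡a = cycSucc-≢ 1≤n j
                       (rainbow k _ _ (subst (λ w → part w ≡ part u) (singleton⇒≡ v v≡a) (singleton⇒≡ (part v) same)))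
    ... | inj₂ v≡b = cycSucc-≢ 1≤n j (trans (cong cycSucc (sym pred≡)) (cycSucc-cycPred j))
      where
      pred≡ : cycPred j ≡ j
      pred≡ = rainbow k _ _ (subst (λ w → part w ≡ part u) (singleton⇒≡ v v≡b) (singleton⇒≡ (part v) same))

    degree-cyc : degree G u ≡ suc s
    degree-cyc = suc-injective (begin
      suc (degree G u)                                ≡⟨ count-insert {P = adj G u} (irrefl G u) ⟨
      count (λ v → adj G u v ∨ singleton u v)         ≡⟨ count-⊎ closed-neighbourhood classmate-not-cycle-neighbour ⟩
      count classmate + count cycle-neighbour         ≡⟨ cong₂ _+_ classmates cycle-neighbours ⟩
      s + 2                                           ≡⟨ +-comm s 2 ⟩
      suc (suc s)                                     ∎)
      where
      open ≡-Reasoning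
      classmates : count classmate ≡ s
      classmates = trans (sym (∣tabulate∣≡count classmate)) (class-size (part u))
      cycle-neighbours : count cycle-neighbour ≡ 2
      cycle-neighbours = begin
        count cycle-neighbour                        ≡⟨ count-∨ {P = singleton a} a≠b ⟩
        count (singleton a) + count (singleton b)    ≡⟨ cong₂ _+_ (count-singleton a) (count-singleton b) ⟩
        2                                            ∎
        where
        a≢b : a ≢ b
        a≢b a≡b = cycSucc²-≢ 2≤n (cycPred j) (trans (cong cycSucc (cycSucc-cycPred j)) (proj₂ (cyc-injective _ _ _ _ a≡b)))
        a≠b : ∀ v → singleton a v ≡ true → singleton b v ≡ true → ⊥
        a≠b v v≡a v≡b = a≢b (trans (sym (singleton⇒≡ v v≡a)) (singleton⇒≡ v v≡b))

  degree-construction : ∀ u → degree G u ≡ suc s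
  degree-construction u = subst (λ x → degree G x ≡ suc s) (cyc-position u) (degree-cyc _ _)

  module _ (S : Subset N) (∣S∣≡s : ∣ S ∣ ≡ s) where

    deletedIn : Fin s → Fin N → Bool
    deletedIn k x = lookup S x ∧ singleton (cycleOf x) k

    deletedOn : Fin s → ℕ
    deletedOn k = count (deletedIn k)

    ∑-deletedOn : sum deletedOn ≡ s
    ∑-deletedOn = begin
      sum deletedOn                                       ≡⟨ ∑-comm (λ k x → indicator (deletedIn k x)) ⟩
      sum (λ x → sum (λ k → indicator (deletedIn k x)))   ≡⟨ sum-cong-≗ (λ x → one-cycle (lookup S x) (cycleOf x)) ⟩
      count (lookup S)                                    ≡⟨ ∣S∣≡count S ⟨
      ∣ S ∣                                               ≡⟨ ∣S∣≡s ⟩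
      s                                                   ∎
      where
      open ≡-Reasoning
      one-cycle : ∀ b c → sum (λ k → indicator (b ∧ singleton c k)) ≡ indicator b
      one-cycle false c = sum-replicate-zero s
      one-cycle true  c = count-singleton c

    deleted-once : (∀ k → ∃[ j ] cyc k j ∈ S) → ∀ k {j j′} → cyc k j ∈ S → cyc k j′ ∈ S → j ≡ j′
    deleted-once hit k {j} {j′} j∈S j′∈S with j F.≟ j′
    ... | yes j≡j′ = j≡j′
    ... | no  j≢j′ = contradiction
      (sum≡size⇒≤1 deletedOn (λ k′ → count-≥1 {P = deletedIn k′} (counted (proj₂ (hit k′)))) ∑-deletedOn k)
      (<⇒≱ (count-≥2 {P = deletedIn k} (j≢j′ ∘ proj₂ ∘ cyc-injective _ _ _ _) (counted j∈S) (counted j′∈S)))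
      where
      counted : ∀ {k i} → cyc k i ∈ S → deletedIn k (cyc k i) ≡ true
      counted {k} {i} i∈S = cong₂ _∧_ (∈⇒lookup i∈S) (≡⇒singleton (sym (cycleOf-cyc k i)))

    same-class-walk : ∀ {x y} → part x ≡ part y → y ∉ S → WalkAvoiding G S x y
    same-class-walk {x} {y} same y∉S with x F.≟ y
    ... | yes refl = here
    ... | no  x≢y  = step (class-edge x≢y same) y∉S here

    through-cycle : ∀ k p → (∀ j → cyc k j ∈ S → j ≡ p) → ∀ {x y} →
                    node k (part x) ∉ S → node k (part y) ∉ S → y ∉ S → WalkAvoiding G S x y
    through-cycle k p only {x} {y} x′∉S y′∉S y∉S =
      walk-++ (same-class-walk (sym (part-node k (part x))) x′∉S)
        (walk-++ (cycle-walk (cyc k) (cycle-edge k) p only _ _ x′∉S y′∉S)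
          (same-class-walk (part-node k (part y)) y∉S))

    node-∉ : ∀ k p → (∀ j → cyc k j ∈ S → j ≡ p) → ∀ {c} → c ≢ part (cyc k p) → node k c ∉ S
    node-∉ k p only {c} c≢ node∈S =
      c≢ (trans (sym (part-node k c)) (cong (part ∘ cyc k) (only _ node∈S)))

    own-node-∉ : ∀ {u} → u ∉ S → node (cycleOf u) (part u) ∉ S
    own-node-∉ {u} = subst (_∉ S) (sym (node-part u))

    connected : ConnectedAfterDeleting G S
    connected u v u∉S v∉S with FP.all? (λ k → FP.any? (λ j → cyc k j ∈? S))
    ... | no ¬hit =
      let k , intact = FP.¬∀⟶∃¬ s _ (λ k → FP.any? (λ j → cyc k j ∈? S)) ¬hit
          clear : ∀ j → cyc k j ∉ S
          clear j j∈S = intact (j , j∈S)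
      in through-cycle k zero (λ j j∈S → contradiction j∈S (clear j)) (clear _) (clear _) v∉S
    ... | yes hit =
      let ku = cycleOf u ; kv = cycleOf v
          pu = proj₁ (hit ku) ; pv = proj₁ (hit kv)
          only-u = λ j j∈S → deleted-once hit ku j∈S (proj₂ (hit ku))
          only-v = λ j j∈S → deleted-once hit kv j∈S (proj₂ (hit kv))
          w , w≢u , w≢v = avoid-two 2≤n (part (cyc ku pu)) (part (cyc kv pv))
          part-x = part-node kv w
      in walk-++ (through-cycle ku pu only-u (own-node-∉ u∉S) (node-∉ ku pu only-u (w≢u ∘ trans (sym part-x)))
                   (node-∉ kv pv only-v w≢v))
                 (through-cycle kv pv only-v (node-∉ kv pv only-v (w≢v ∘ trans (sym part-x))) (own-node-∉ v∉S) v∉S)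

  robust : Robust s G
  robust = connected

n+2≤L*n : ∀ {L n} → 3 ≤ L → 1 ≤ n → n + 2 ≤ L * n
n+2≤L*n {L} {n} 3≤L 1≤n =
  ≤-trans (+-monoʳ-≤ n (+-mono-≤ 1≤n (≤-trans 1≤n (m≤m+n n 0)))) (*-monoˡ-≤ n 3≤L)

theorem4 : ∀ (m N s : ℕ) → 1 < m → 0 < N → N ≡ 2 * m * s →
    (part : Fin N → Fin (2 * m)) →
    (∀ i → ∣ classOf part i ∣ ≡ s) →
    (cyc : Fin s → Fin (2 * m) → Fin N) →
    (∀ k j k′ j′ → cyc k j ≡ cyc k′ j′ → k ≡ k′ × j ≡ j′) →
    (∀ u → ∃[ k ] ∃[ j ] cyc k j ≡ u) →
    (∀ k j j′ → part (cyc k j) ≡ part (cyc k j′) → j ≡ j′) →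
    (G : Graph N) →
    (∀ u v → (adj G u v ≡ true) ⇔ ConstructionLink part cyc u v) →
    Robust s G × (∀ (H : Graph N) → Robust s H → numLinks G ≤ numLinks H)
theorem4 (suc zero) _ _ (s≤s ()) _ _ _ _ _ _ _ _ _ _
theorem4 (suc (suc m)) N zero _ 0<N N≡0 _ _ _ _ _ _ _ _ =
  contradiction (trans N≡0 (*-zeroʳ (2 * suc (suc m)))) (>⇒≢ 0<N)
theorem4 (suc (suc m)) N (suc s) _ _ N≡ part class-size cyc cyc-injective cyc-surjective rainbow G links =
  C.robust , λ H → regular⇒fewest-links (suc s) G H s+2≤N C.degree-construction
  where
  3≤2m : 3 ≤ 2 * suc (suc m)
  3≤2m = ≤-trans (n≤1+n 3) (*-monoʳ-≤ 2 (s≤s (s≤s z≤n)))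
  s+2≤N : suc s + 2 ≤ N
  s+2≤N = subst (suc s + 2 ≤_) (sym N≡) (n+2≤L*n 3≤2m (s≤s z≤n))
  module C = Construction (≤-pred 3≤2m) part class-size cyc cyc-injective cyc-surjective rainbow G links
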